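{- Let $m\ge1$ and let $\underline{r}=(r_1,\dots,r_m)$ be pairwise coprime integers $r_i\ge2$. Let $CP_{\underline{r},n}$ be the set of partitions of $n$ none of whose parts is divisible by any $r_l$, and $m_i(\lambda)$ the multiplicity of $i$ in $\lambda$. Let $W_{\underline{r},s,n}=\sum_{\rho\in CP_{\underline{r},n}}|\{i\ge1\mid m_i(\rho)\ge s\}|$ and $$c_{r_1,n}=\sum_{\substack{j\ge 1\\ r_l\nmid j \text{ for all } l}}\ \sum_{k_1,\dots,k_m\ge0} k_1\, W_{\underline{r},\,r_1^{k_1}\cdots r_m^{k_m}j,\,n}.$$ For $\lambda\in CP_{\underline{r},n}$, $j\ge1$ with $r_1\nmid j$ and $k\ge 1$, put $y_{r_1^kj}(\lambda)=|\{i\ge1\mid m_i(\lambda)\ge r_1^kj\}|$, $G_j(\lambda)=\sum_{k\ge1}k\,y_{r_1^kj}(\lambda)$, and $G(\lambda)=\sum_{j\ge1,\ r_1\nmid j}G_j(\lambda)$. Then $$c_{r_1,n}=\sum_{\lambda\in CP_{\underline{r},n}}G(\lambda).$$ -}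

module Defs where

open import Data.Nat using (ℕ; zero; suc; _+_; _*_; _^_; _≤_; _≥_; _≤?_; _≟_)
open import Data.Nat.Divisibility using (_∣_; _∣?_)
open import Data.Nat.Coprimality using (Coprime)
open import Data.Fin using (Fin)
import Data.Fin as Fin
open import Data.Fin.Properties using (all?)
open import Data.Vec.Functional using () renaming (_∷_ to _∷ᶠ_)
open import Data.Nat.ListAction using (sum)
open import Data.List using (List; []; _∷_; map; filter; length; applyUpTo)
open import Data.List.Relation.Unary.All using (All)
open import Data.List.Relation.Unary.Linked using (Linked)
open import Data.List.Relation.Unary.Unique.Propositional using (Unique)
open import Data.List.Membership.Propositional using (_∈_)
open import Relation.Nullary using (¬_; Dec; yes; no)
open import Relation.Nullary.Decidable using (¬?)
open import Relation.Binary.PropositionalEquality using (_≡_; _≢_)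
open import Function.Bundles using (_⇔_)
open import Data.Product using (_×_)

range : ℕ → ℕ → List ℕ
range a b = applyUpTo (a +_) (suc b Data.Nat.∸ a)

sumRange : ℕ → ℕ → (ℕ → ℕ) → ℕ
sumRange a b f = sum (map f (range a b))

sumRangeIf : ℕ → ℕ → {P : ℕ → Set} → ((i : ℕ) → Dec (P i)) → (ℕ → ℕ) → ℕ
sumRangeIf a b P? f = sum (map f (filter P? (range a b)))

sumTuples : (d : ℕ) → ℕ → ((Fin d → ℕ) → ℕ) → ℕ
sumTuples zero    B F = F (λ ())
sumTuples (suc d) B F = sumRange 0 B (λ k → sumTuples d B (λ ks → F (k ∷ᶠ ks)))

prodFin : (d : ℕ) → (Fin d → ℕ) → ℕ
prodFin zero    f = 1
prodFin (suc d) f = f Fin.zero * prodFin d (λ l → f (Fin.suc l))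

IsPartition : ℕ → List ℕ → Set
IsPartition n λ′ = All (λ p → p ≥ 1) λ′ × Linked (λ a b → b ≤ a) λ′ × sum λ′ ≡ n

mult : ℕ → List ℕ → ℕ
mult i []       = 0
mult i (p ∷ ps) with p ≟ i
... | yes _ = suc (mult i ps)
... | no  _ = mult i ps

PairwiseCoprime : {d : ℕ} → (Fin d → ℕ) → Set
PairwiseCoprime {d} r = ∀ (a b : Fin d) → a ≢ b → Coprime (r a) (r b)

NotDivByAny : {d : ℕ} → (Fin d → ℕ) → ℕ → Set
NotDivByAny r x = ∀ l → ¬ (r l ∣ x)

notDivByAny? : {d : ℕ} → (r : Fin d → ℕ) → (x : ℕ) → Dec (NotDivByAny r x)
notDivByAny? r x = all? (λ l → ¬? (r l ∣? x))

IsCP : {d : ℕ} → (Fin d → ℕ) → ℕ → List ℕ → Set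
IsCP r n λ′ = IsPartition n λ′ × All (NotDivByAny r) λ′

-- L is an enumeration of CP_{r,n} without repetition (i.e. L represents the finite set)
Enumerates : {d : ℕ} → (Fin d → ℕ) → ℕ → List (List ℕ) → Set
Enumerates r n L = Unique L × (∀ λ′ → (λ′ ∈ L) ⇔ IsCP r n λ′)

-- |{ i ≥ 1 | m_i(λ) ≥ s }|.  Any i with m_i(λ) ≥ 1 is ≤ sum λ, so for s ≥ 1
-- it suffices to let i range over 1..sum λ.
y : ℕ → List ℕ → ℕ
y s λ′ = length (filter (λ i → s ≤? mult i λ′) (range 1 (sum λ′)))

W : List (List ℕ) → ℕ → ℕ
W L s = sum (map (y s) L)

-- c_{r_1,n} for r = (r_1,...,r_{m}) given as r : Fin (suc m') → ℕ, r_1 = r zero.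
-- Indices truncated at n: for j > n or any k_l > n the index s = Π r_l^{k_l} j
-- exceeds n (r_l ≥ 2), so W vanishes; all omitted terms are zero.
c : (m' : ℕ) → (Fin (suc m') → ℕ) → ℕ → List (List ℕ) → ℕ
c m' r n L =
  sumRangeIf 1 n (notDivByAny? r) (λ j →
    sumTuples (suc m') n (λ k →
      k Fin.zero * W L (prodFin (suc m') (λ l → r l ^ k l) * j)))

-- G_j(λ) = Σ_{k ≥ 1} k y_{r_1^k j}(λ)   (truncated at k ≤ n; omitted terms vanish)
Gj : ℕ → ℕ → ℕ → List ℕ → ℕ
Gj r₁ n j λ′ = sumRange 1 n (λ k → k * y (r₁ ^ k * j) λ′)

-- G(λ) = Σ_{j ≥ 1, r_1 ∤ j} G_j(λ)   (truncated at j ≤ n; omitted terms vanish)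
G : ℕ → ℕ → List ℕ → ℕ
G r₁ n λ′ = sumRangeIf 1 n (λ j → ¬? (r₁ ∣? j)) (λ j → Gj r₁ n j λ′)

-- Both sides are linear in the multiplicity profile s ↦ y_s(λ), and every such
-- profile vanishes for s > n.  So it suffices to show, for any f : ℕ → ℕ with
-- f s = 0 for s > n,
--
--   Σ_{j : no r_l ∣ j} Σ_{k₁,…,k_m} k₁ f(r₁^{k₁}⋯r_m^{k_m} j)
--     = Σ_{j : r₁ ∤ j} Σ_{k ≥ 1} k f(r₁^k j).                          (★)
--
-- The heart of (★) is unique factorisation with respect to pairwise coprime
-- q₁,…,q_t ≥ 2: every x ≥ 1 is uniquely q₁^{k₁}⋯q_t^{k_t} j with no q_l ∣ j, hence
-- Σ_j [no q_l ∣ j] Σ_k g(q^k j) = Σ_x g(x) (factorisation-sum).  It is proved by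
-- induction on t, peeling off one modulus at a time (factorSum-peel); the case
-- of a single modulus (strip-powers) iterates the splitting of 1..n into
-- non-multiples and multiples of q (Σ₁-multiples).  Applying the peeling step to
-- r₁ and factorisation-sum to r₂,…,r_m yields (★) (c-as-G); linearity of the right
-- side and the vanishing of y_s(λ) for s > n give the proposition.
module Submission where

open import Defs
open import Data.Nat using (ℕ; zero; suc; _+_; _*_; _^_; _∸_; _≤_; _<_; _≥_; z≤n; s≤s; _≟_; _≤?_)
open import Data.Nat.Properties
open import Data.Nat.Divisibility using (_∣_; _∣?_; m∣m*n; ∣n⇒∣m*n; ∣m+n∣m⇒∣n; ∣⇒≤)
open import Data.Nat.Coprimality using (Coprime; coprime-divisor)
open import Data.Nat.ListAction using (sum)
open import Data.Nat.Solver using (module +-*-Solver)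
open import Data.Fin using (Fin; zero; suc)
open import Data.Fin.Properties using () renaming (suc-injective to Fin-suc-injective)
open import Data.Vec.Functional using () renaming (_∷_ to _∷ᶠ_)
open import Data.List using (List; []; _∷_; map; filter; length; applyUpTo)
open import Data.List.Properties using (map-cong; filter-none)
open import Data.List.Relation.Unary.All using (All; []; _∷_; universal)
open import Data.List.Relation.Unary.Any using (here; there)
open import Data.List.Membership.Propositional using (_∈_)
open import Data.Product using (_,_)
open import Function using (_∘_)
open import Function.Bundles using (Equivalence)
open import Relation.Nullary using (Dec; yes; no; ¬_; contradiction)
open import Relation.Nullary.Decidable using (¬?; _×-dec_)
open import Relation.Binary.PropositionalEquality
open import Algebra.Properties.CommutativeSemigroup +-commutativeSemigroup using ()
  renaming (interchange to +-interchange)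
open import Algebra.Properties.CommutativeSemigroup *-commutativeSemigroup using ()
  renaming (x∙yz≈y∙xz to x*[y*z]≡y*[x*z])

open ≡-Reasoning

Σ< : ℕ → (ℕ → ℕ) → ℕ
Σ< zero    h = 0
Σ< (suc n) h = h 0 + Σ< n (h ∘ suc)

Σ₁ : ℕ → (ℕ → ℕ) → ℕ
Σ₁ n f = Σ< n (f ∘ suc)

Σ<-cong : ∀ n {h h′ : ℕ → ℕ} → (∀ i → i < n → h i ≡ h′ i) → Σ< n h ≡ Σ< n h′
Σ<-cong zero    eq = refl
Σ<-cong (suc n) eq = cong₂ _+_ (eq 0 (s≤s z≤n)) (Σ<-cong n (λ i i<n → eq (suc i) (s≤s i<n)))

Σ<-zero : ∀ n {h : ℕ → ℕ} → (∀ i → i < n → h i ≡ 0) → Σ< n h ≡ 0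
Σ<-zero zero    eq = refl
Σ<-zero (suc n) eq = cong₂ _+_ (eq 0 (s≤s z≤n)) (Σ<-zero n (λ i i<n → eq (suc i) (s≤s i<n)))

Σ<-+ : ∀ n (a b : ℕ → ℕ) → Σ< n (λ i → a i + b i) ≡ Σ< n a + Σ< n b
Σ<-+ zero    a b = refl
Σ<-+ (suc n) a b = begin
  a 0 + b 0 + Σ< n (λ i → a (suc i) + b (suc i))  ≡⟨ cong (a 0 + b 0 +_) (Σ<-+ n (a ∘ suc) (b ∘ suc)) ⟩
  a 0 + b 0 + (Σ< n (a ∘ suc) + Σ< n (b ∘ suc))   ≡⟨ +-interchange (a 0) (b 0) _ _ ⟩
  a 0 + Σ< n (a ∘ suc) + (b 0 + Σ< n (b ∘ suc))   ∎

Σ<-* : ∀ n c (h : ℕ → ℕ) → Σ< n (λ i → c * h i) ≡ c * Σ< n h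
Σ<-* zero    c h = sym (*-zeroʳ c)
Σ<-* (suc n) c h = trans (cong (c * h 0 +_) (Σ<-* n c (h ∘ suc))) (sym (*-distribˡ-+ c (h 0) _))

Σ<-comm : ∀ n m (F : ℕ → ℕ → ℕ) → Σ< n (λ i → Σ< m (F i)) ≡ Σ< m (λ k → Σ< n (λ i → F i k))
Σ<-comm zero    m F = sym (Σ<-zero m (λ _ _ → refl))
Σ<-comm (suc n) m F = begin
  Σ< m (F 0) + Σ< n (λ i → Σ< m (F (suc i)))        ≡⟨ cong (Σ< m (F 0) +_) (Σ<-comm n m (F ∘ suc)) ⟩
  Σ< m (F 0) + Σ< m (λ k → Σ< n (λ i → F (suc i) k)) ≡⟨ sym (Σ<-+ m (F 0) _) ⟩
  Σ< m (λ k → Σ< (suc n) (λ i → F i k))              ∎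

Σ<-split : ∀ a b h → Σ< (a + b) h ≡ Σ< a h + Σ< b (λ i → h (a + i))
Σ<-split zero    b h = refl
Σ<-split (suc a) b h = trans (cong (h 0 +_) (Σ<-split a b (h ∘ suc))) (sym (+-assoc (h 0) _ _))

Σ<-snoc : ∀ n h → Σ< (suc n) h ≡ Σ< n h + h n
Σ<-snoc zero    h = +-comm (h 0) 0
Σ<-snoc (suc n) h = trans (cong (h 0 +_) (Σ<-snoc n (h ∘ suc))) (sym (+-assoc (h 0) _ _))

Σ<-truncate : ∀ {n N} h → n ≤ N → (∀ i → n ≤ i → h i ≡ 0) → Σ< N h ≡ Σ< n h
Σ<-truncate {n} {N} h n≤N vanish = begin
  Σ< N h                                  ≡⟨ cong (λ M → Σ< M h) (sym (m+[n∸m]≡n n≤N)) ⟩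
  Σ< (n + (N ∸ n)) h                      ≡⟨ Σ<-split n (N ∸ n) h ⟩
  Σ< n h + Σ< (N ∸ n) (λ i → h (n + i))   ≡⟨ cong (Σ< n h +_) (Σ<-zero (N ∸ n) (λ i _ → vanish (n + i) (m≤m+n n i))) ⟩
  Σ< n h + 0                              ≡⟨ +-identityʳ _ ⟩
  Σ< n h                                  ∎

𝟙 : {P : Set} → Dec P → ℕ
𝟙 (yes _) = 1
𝟙 (no _)  = 0

𝟙-yes : {P : Set} → P → (p? : Dec P) → 𝟙 p? ≡ 1
𝟙-yes p (yes _) = refl
𝟙-yes p (no ¬p) = contradiction p ¬p

𝟙-no : {P : Set} → ¬ P → (p? : Dec P) → 𝟙 p? ≡ 0
𝟙-no ¬p (yes p) = contradiction p ¬p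
𝟙-no ¬p (no _)  = refl

𝟙-cong : {P Q : Set} → (P → Q) → (Q → P) → (p? : Dec P) (q? : Dec Q) → 𝟙 p? ≡ 𝟙 q?
𝟙-cong to from (yes p) q? = sym (𝟙-yes (to p) q?)
𝟙-cong to from (no ¬p) q? = sym (𝟙-no (¬p ∘ from) q?)

𝟙-× : {P Q : Set} (p? : Dec P) (q? : Dec Q) → 𝟙 (p? ×-dec q?) ≡ 𝟙 p? * 𝟙 q?
𝟙-× (yes _) (yes _) = refl
𝟙-× (yes _) (no _)  = refl
𝟙-× (no _)  _       = refl

𝟙-partition : {P : Set} (p? : Dec P) (a : ℕ) → a ≡ 𝟙 (¬? p?) * a + 𝟙 p? * a
𝟙-partition (yes _) a = sym (+-identityʳ a)
𝟙-partition (no _)  a = sym (trans (+-identityʳ (a + 0)) (+-identityʳ a))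

sum-applyUpTo : ∀ n (f g : ℕ → ℕ) → sum (map f (applyUpTo g n)) ≡ Σ< n (f ∘ g)
sum-applyUpTo zero    f g = refl
sum-applyUpTo (suc n) f g = cong (f (g 0) +_) (sum-applyUpTo n f (g ∘ suc))

sum-filter : ∀ {P : ℕ → Set} (P? : ∀ x → Dec (P x)) (f : ℕ → ℕ) xs →
             sum (map f (filter P? xs)) ≡ sum (map (λ x → 𝟙 (P? x) * f x) xs)
sum-filter P? f []       = refl
sum-filter P? f (x ∷ xs) with P? x
... | yes _ = cong₂ _+_ (sym (+-identityʳ (f x))) (sum-filter P? f xs)
... | no _  = sum-filter P? f xs

sumRange-1 : ∀ n f → sumRange 1 n f ≡ Σ₁ n f
sumRange-1 n f = sum-applyUpTo n f suc

sumRangeIf-1 : ∀ n {P : ℕ → Set} (P? : ∀ x → Dec (P x)) f →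
               sumRangeIf 1 n P? f ≡ Σ₁ n (λ x → 𝟙 (P? x) * f x)
sumRangeIf-1 n P? f = trans (sum-filter P? f (range 1 n)) (sum-applyUpTo n _ suc)

sumTuples-suc : ∀ d B F → sumTuples (suc d) B F ≡ Σ< (suc B) (λ k → sumTuples d B (λ ks → F (k ∷ᶠ ks)))
sumTuples-suc d B F = sum-applyUpTo (suc B) _ (λ i → i)

sumTuples-cong : ∀ d B {F F′ : (Fin d → ℕ) → ℕ} → (∀ ks → F ks ≡ F′ ks) → sumTuples d B F ≡ sumTuples d B F′
sumTuples-cong zero    B eq = eq _
sumTuples-cong (suc d) B {F} {F′} eq = begin
  sumTuples (suc d) B F                                      ≡⟨ sumTuples-suc d B F ⟩
  Σ< (suc B) (λ k → sumTuples d B (λ ks → F (k ∷ᶠ ks)))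
    ≡⟨ Σ<-cong (suc B) (λ k _ → sumTuples-cong d B (λ ks → eq (k ∷ᶠ ks))) ⟩
  Σ< (suc B) (λ k → sumTuples d B (λ ks → F′ (k ∷ᶠ ks)))    ≡⟨ sym (sumTuples-suc d B F′) ⟩
  sumTuples (suc d) B F′                                     ∎

sumTuples-* : ∀ d B c F → sumTuples d B (λ ks → c * F ks) ≡ c * sumTuples d B F
sumTuples-* zero    B c F = refl
sumTuples-* (suc d) B c F = begin
  sumTuples (suc d) B (λ ks → c * F ks)                          ≡⟨ sumTuples-suc d B (λ ks → c * F ks) ⟩
  Σ< (suc B) (λ k → sumTuples d B (λ ks → c * F (k ∷ᶠ ks)))
    ≡⟨ Σ<-cong (suc B) (λ k _ → sumTuples-* d B c (λ ks → F (k ∷ᶠ ks))) ⟩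
  Σ< (suc B) (λ k → c * sumTuples d B (λ ks → F (k ∷ᶠ ks)))
    ≡⟨ Σ<-* (suc B) c (λ k → sumTuples d B (λ ks → F (k ∷ᶠ ks))) ⟩
  c * Σ< (suc B) (λ k → sumTuples d B (λ ks → F (k ∷ᶠ ks)))     ≡⟨ cong (c *_) (sym (sumTuples-suc d B F)) ⟩
  c * sumTuples (suc d) B F                                      ∎

-- The monomial q₁^{k₁}⋯q_t^{k_t}; it unfolds definitionally as
-- monomial (suc t) q (k ∷ ks) = q₀^k · monomial t (q ∘ suc) ks.
monomial : (t : ℕ) → (Fin t → ℕ) → (Fin t → ℕ) → ℕ
monomial t q ks = prodFin t (λ l → q l ^ ks l)

∣-cancel-power : ∀ {a b} k {x} → Coprime a b → a ∣ b ^ k * x → a ∣ x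
∣-cancel-power {a}     zero    {x} _   a∣ = subst (a ∣_) (*-identityˡ x) a∣
∣-cancel-power {a} {b} (suc k) {x} cop a∣ =
  ∣-cancel-power k cop (coprime-divisor cop (subst (a ∣_) (*-assoc b (b ^ k) x) a∣))

∣-cancel-monomial : ∀ t {a} (q ks : Fin t → ℕ) {x} → (∀ l → Coprime a (q l)) → a ∣ monomial t q ks * x → a ∣ x
∣-cancel-monomial zero    {a} q ks {x} _   a∣ = subst (a ∣_) (*-identityˡ x) a∣
∣-cancel-monomial (suc t) {a} q ks {x} cop a∣ =
  ∣-cancel-monomial t (q ∘ suc) (ks ∘ suc) (cop ∘ suc)
    (∣-cancel-power (ks zero) (cop zero) (subst (a ∣_) (*-assoc (q zero ^ ks zero) (monomial t (q ∘ suc) (ks ∘ suc)) x) a∣))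

𝟙-∤-monomial : ∀ t {a} (q ks : Fin t → ℕ) x → (∀ l → Coprime a (q l)) →
               𝟙 (¬? (a ∣? monomial t q ks * x)) ≡ 𝟙 (¬? (a ∣? x))
𝟙-∤-monomial t q ks x cop =
  𝟙-cong (λ a∤ a∣ → a∤ (∣n⇒∣m*n (monomial t q ks) a∣)) (λ a∤ a∣ → a∤ (∣-cancel-monomial t q ks cop a∣)) _ _

𝟙-notDivByAny : ∀ {t} (q : Fin (suc t) → ℕ) x →
                𝟙 (notDivByAny? q x) ≡ 𝟙 (¬? (q zero ∣? x)) * 𝟙 (notDivByAny? (q ∘ suc) x)
𝟙-notDivByAny q x = trans (𝟙-cong to from (notDivByAny? q x) (head? ×-dec tail?)) (𝟙-× head? tail?)
  where
  head? = ¬? (q zero ∣? x)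
  tail? = notDivByAny? (q ∘ suc) x
  to : NotDivByAny q x → _
  to nd = nd zero , nd ∘ suc
  from : _ → NotDivByAny q x
  from (nd₀ , nd₊) zero    = nd₀
  from (nd₀ , nd₊) (suc l) = nd₊ l

pairwiseCoprime-head : ∀ {t} {q : Fin (suc t) → ℕ} → PairwiseCoprime q → ∀ l → Coprime (q zero) (q (suc l))
pairwiseCoprime-head pc l = pc zero (suc l) (λ ())

pairwiseCoprime-tail : ∀ {t} {q : Fin (suc t) → ℕ} → PairwiseCoprime q → PairwiseCoprime (q ∘ suc)
pairwiseCoprime-tail pc a b a≢b = pc (suc a) (suc b) (a≢b ∘ Fin-suc-injective)

Vanish : ℕ → (ℕ → ℕ) → Set
Vanish n g = ∀ s → n < s → g s ≡ 0

Vanish-scale : ∀ {n g} a → 1 ≤ a → Vanish n g → Vanish n (λ x → g (a * x))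
Vanish-scale a 1≤a v s n<s = v (a * s) (≤-trans n<s (subst (_≤ a * s) (*-identityˡ s) (*-monoˡ-≤ s 1≤a)))

Vanish-weight : ∀ {n g} (w : ℕ → ℕ) → Vanish n g → Vanish n (λ x → w x * g x)
Vanish-weight w v s n<s = trans (cong (w s *_) (v s n<s)) (*-zeroʳ (w s))

1≤^ : ∀ {q} k → 1 ≤ q → 1 ≤ q ^ k
1≤^ {q} k 1≤q = subst (_≤ q ^ k) (^-zeroˡ k) (^-monoˡ-≤ k 1≤q)

n<q^n : ∀ {q} → 2 ≤ q → ∀ n → n < q ^ n
n<q^n q≥2 zero        = s≤s z≤n
n<q^n {q} q≥2 (suc n) = ≤-<-trans (n<q^n q≥2 n) (^-monoʳ-< q q≥2 (n<1+n n))

-- The k-th q-adic slice of g: x ↦ [q ∤ x] · g(q^k x).  Summed over x it collects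
-- the values of g at the numbers of q-adic valuation exactly k.
slice : ℕ → ℕ → (ℕ → ℕ) → ℕ → ℕ
slice q k g x = 𝟙 (¬? (q ∣? x)) * g (q ^ k * x)

slice-vanish : ∀ {n q} k (g : ℕ → ℕ) → 1 ≤ q → Vanish n g → Vanish n (slice q k g)
slice-vanish {q = q} k g 1≤q v = Vanish-weight (λ x → 𝟙 (¬? (q ∣? x))) (Vanish-scale (q ^ k) (1≤^ k 1≤q) v)

-- For q = suc p and g supported in [0, n], the multiples of q in 1..n contribute
-- Σ_{x ≤ n, q ∣ x} g(x) = Σ_{i ≤ n} g(q i)  (cut 1..qn into blocks of length q).
Σ₁-multiples : ∀ p {n} (g : ℕ → ℕ) → Vanish n g →
               Σ₁ n (λ x → 𝟙 (suc p ∣? x) * g x) ≡ Σ₁ n (λ i → g (suc p * i))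
Σ₁-multiples p {n} g v = begin
  Σ< n F
    ≡⟨ sym (Σ<-truncate F (m≤n*m n q) (λ i n≤i → Vanish-weight (λ x → 𝟙 (q ∣? x)) v (suc i) (s≤s n≤i))) ⟩
  Σ< (q * n) F            ≡⟨ blocks n ⟩
  Σ₁ n (λ i → g (q * i))  ∎
  where
  q = suc p
  F : ℕ → ℕ
  F i = 𝟙 (q ∣? suc i) * g (suc i)

  -- Among qM+1, …, qM+q only the last is a multiple of q.
  block : ∀ M → Σ< q (λ d → F (q * M + d)) ≡ g (q * suc M)
  block M = begin
    Σ< (suc p) (λ d → F (q * M + d))            ≡⟨ Σ<-snoc p _ ⟩
    Σ< p (λ d → F (q * M + d)) + F (q * M + p)  ≡⟨ cong₂ _+_ (Σ<-zero p non-multiple) last ⟩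
    g (q * suc M)                                ∎
    where
    non-multiple : ∀ d → d < p → F (q * M + d) ≡ 0
    non-multiple d d<p = cong (_* g (suc (q * M + d))) (𝟙-no q∤ (q ∣? suc (q * M + d)))
      where
      q∤ : ¬ q ∣ suc (q * M + d)
      q∤ q∣ = <⇒≱ (s≤s d<p) (∣⇒≤ (∣m+n∣m⇒∣n (subst (q ∣_) (sym (+-suc (q * M) d)) q∣) (m∣m*n M)))
    top : suc (q * M + p) ≡ q * suc M
    top = trans (cong suc (+-comm (q * M) p)) (sym (*-suc q M))
    last : F (q * M + p) ≡ g (q * suc M)
    last = begin
      𝟙 (q ∣? suc (q * M + p)) * g (suc (q * M + p))  ≡⟨ cong (λ x → 𝟙 (q ∣? x) * g x) top ⟩
      𝟙 (q ∣? q * suc M) * g (q * suc M)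
        ≡⟨ cong (_* g (q * suc M)) (𝟙-yes (m∣m*n (suc M)) (q ∣? q * suc M)) ⟩
      1 * g (q * suc M)                                ≡⟨ *-identityˡ _ ⟩
      g (q * suc M)                                    ∎

  blocks : ∀ M → Σ< (q * M) F ≡ Σ₁ M (λ i → g (q * i))
  blocks zero    = cong (λ N → Σ< N F) (*-zeroʳ q)
  blocks (suc M) = begin
    Σ< (q * suc M) F                            ≡⟨ cong (λ N → Σ< N F) (trans (*-suc q M) (+-comm q (q * M))) ⟩
    Σ< (q * M + q) F                            ≡⟨ Σ<-split (q * M) q F ⟩
    Σ< (q * M) F + Σ< q (λ d → F (q * M + d))  ≡⟨ cong₂ _+_ (blocks M) (block M) ⟩
    Σ₁ M (λ i → g (q * i)) + g (q * suc M)      ≡⟨ sym (Σ<-snoc M _) ⟩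
    Σ₁ (suc M) (λ i → g (q * i))                ∎

Σ₁-split-multiples : ∀ q → 1 ≤ q → ∀ {n} (g : ℕ → ℕ) → Vanish n g →
                     Σ₁ n g ≡ Σ₁ n (λ x → 𝟙 (¬? (q ∣? x)) * g x) + Σ₁ n (λ x → g (q * x))
Σ₁-split-multiples (suc p) _ {n} g v = begin
  Σ₁ n g
    ≡⟨ Σ<-cong n (λ x _ → 𝟙-partition (suc p ∣? suc x) _) ⟩
  Σ₁ n (λ x → 𝟙 (¬? (suc p ∣? x)) * g x + 𝟙 (suc p ∣? x) * g x)           ≡⟨ Σ<-+ n _ _ ⟩
  Σ₁ n (λ x → 𝟙 (¬? (suc p ∣? x)) * g x) + Σ₁ n (λ x → 𝟙 (suc p ∣? x) * g x)
    ≡⟨ cong (Σ₁ n (λ x → 𝟙 (¬? (suc p ∣? x)) * g x) +_) (Σ₁-multiples p g v) ⟩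
  Σ₁ n (λ x → 𝟙 (¬? (suc p ∣? x)) * g x) + Σ₁ n (λ x → g (suc p * x))      ∎

strip-powers-below : ∀ K q → 1 ≤ q → ∀ {n} (g : ℕ → ℕ) → Vanish n g →
  Σ₁ n g ≡ Σ< K (λ k → Σ₁ n (slice q k g)) + Σ₁ n (λ x → g (q ^ K * x))
strip-powers-below zero    q _   {n} g v = Σ<-cong n (λ x _ → cong g (sym (*-identityˡ (suc x))))
strip-powers-below (suc K) q 1≤q {n} g v = begin
  Σ₁ n g                                                    ≡⟨ strip-powers-below K q 1≤q g v ⟩
  Σ< K T + Σ₁ n (λ x → g (q ^ K * x))
    ≡⟨ cong (Σ< K T +_) (Σ₁-split-multiples q 1≤q _ (Vanish-scale (q ^ K) (1≤^ K 1≤q) v)) ⟩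
  Σ< K T + (T K + Σ₁ n (λ x → g (q ^ K * (q * x))))         ≡⟨ sym (+-assoc (Σ< K T) _ _) ⟩
  Σ< K T + T K + Σ₁ n (λ x → g (q ^ K * (q * x)))
    ≡⟨ cong₂ _+_ (sym (Σ<-snoc K T)) (Σ<-cong n (λ x _ → cong g (power-step (suc x)))) ⟩
  Σ< (suc K) T + Σ₁ n (λ x → g (q ^ suc K * x))             ∎
  where
  T : ℕ → ℕ
  T k = Σ₁ n (slice q k g)
  power-step : ∀ x → q ^ K * (q * x) ≡ q ^ suc K * x
  power-step x = trans (sym (*-assoc (q ^ K) q x)) (cong (_* x) (*-comm (q ^ K) q))

-- Every x ≥ 1 is uniquely q^k·j with q ∤ j; for g supported in [0, n] only k ≤ n matter.
strip-powers : ∀ q → 2 ≤ q → ∀ {n} (g : ℕ → ℕ) → Vanish n g →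
               Σ< (suc n) (λ k → Σ₁ n (slice q k g)) ≡ Σ₁ n g
strip-powers q q≥2 {n} g v = sym (begin
  Σ₁ n g                                                  ≡⟨ strip-powers-below (suc n) q (<⇒≤ q≥2) g v ⟩
  Σ< (suc n) T + Σ₁ n (λ x → g (q ^ suc n * x))
    ≡⟨ cong (Σ< (suc n) T +_) (Σ<-zero n (λ x _ → v _ (beyond x))) ⟩
  Σ< (suc n) T + 0                                        ≡⟨ +-identityʳ _ ⟩
  Σ< (suc n) T                                            ∎)
  where
  T : ℕ → ℕ
  T k = Σ₁ n (slice q k g)
  beyond : ∀ x → n < q ^ suc n * suc x
  beyond x = <-≤-trans (<-trans (n<1+n n) (n<q^n q≥2 (suc n))) (m≤m*n (q ^ suc n) (suc x))

factorSum : ∀ t → (Fin t → ℕ) → ℕ → (ℕ → ℕ) → ℕ → ℕ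
factorSum t q n g j = 𝟙 (notDivByAny? q j) * sumTuples t n (λ ks → g (monomial t q ks * j))

-- Peeling off the exponent k of the first modulus q₀ (with a weight w(k)): the
-- condition q₀ ∤ j moves into the summand, where by coprimality it may be
-- tested on the whole remaining monomial times j.
factorSum-peel : ∀ t (q : Fin (suc t) → ℕ) n (w g : ℕ → ℕ) j → (∀ l → Coprime (q zero) (q (suc l))) →
  𝟙 (notDivByAny? q j) * sumTuples (suc t) n (λ ks → w (ks zero) * g (monomial (suc t) q ks * j))
    ≡ Σ< (suc n) (λ k → w k * factorSum t (q ∘ suc) n (slice (q zero) k g) j)
factorSum-peel t q n w g j cop = begin
  𝟙 (notDivByAny? q j) * sumTuples (suc t) n (λ ks → w (ks zero) * g (monomial (suc t) q ks * j))
    ≡⟨ cong₂ _*_ (𝟙-notDivByAny q j) (sumTuples-suc t n (λ ks → w (ks zero) * g (monomial (suc t) q ks * j))) ⟩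
  a * b * Σ< (suc n) (λ k → sumTuples t n (λ ks → w k * term k ks))
    ≡⟨ sym (Σ<-* (suc n) (a * b) (λ k → sumTuples t n (λ ks → w k * term k ks))) ⟩
  Σ< (suc n) (λ k → a * b * sumTuples t n (λ ks → w k * term k ks))
    ≡⟨ Σ<-cong (suc n) (λ k _ → per-exponent k) ⟩
  Σ< (suc n) (λ k → w k * factorSum t (q ∘ suc) n (slice (q zero) k g) j) ∎
  where
  open +-*-Solver
  a = 𝟙 (¬? (q zero ∣? j))
  b = 𝟙 (notDivByAny? (q ∘ suc) j)
  term : ℕ → (Fin t → ℕ) → ℕ
  term k ks = g (q zero ^ k * monomial t (q ∘ suc) ks * j)
  per-exponent : ∀ k → a * b * sumTuples t n (λ ks → w k * term k ks)
    ≡ w k * factorSum t (q ∘ suc) n (slice (q zero) k g) j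
  per-exponent k = begin
    a * b * sumTuples t n (λ ks → w k * term k ks)     ≡⟨ cong (a * b *_) (sumTuples-* t n (w k) _) ⟩
    a * b * (w k * sumTuples t n (term k))
      ≡⟨ solve 4 (λ a b c d → a :* b :* (c :* d) := c :* (b :* (a :* d))) refl a b (w k) _ ⟩
    w k * (b * (a * sumTuples t n (term k)))           ≡⟨ cong (λ s → w k * (b * s)) (sym (sumTuples-* t n a _)) ⟩
    w k * (b * sumTuples t n (λ ks → a * term k ks))   ≡⟨ cong (λ s → w k * (b * s)) (sumTuples-cong t n regroup) ⟩
    w k * factorSum t (q ∘ suc) n (slice (q zero) k g) j ∎
    where
    regroup : ∀ ks → a * term k ks ≡ slice (q zero) k g (monomial t (q ∘ suc) ks * j)
    regroup ks = cong₂ _*_ (sym (𝟙-∤-monomial t (q ∘ suc) ks j cop)) (cong g (*-assoc (q zero ^ k) _ j))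

-- Unique factorisation x = q₁^{k₁}⋯q_t^{k_t} j (no q_l ∣ j) for pairwise coprime
-- q_l ≥ 2, in summed form.
factorisation-sum : ∀ t (q : Fin t → ℕ) → (∀ l → 2 ≤ q l) → PairwiseCoprime q →
                    ∀ {n} (g : ℕ → ℕ) → Vanish n g → Σ₁ n (factorSum t q n g) ≡ Σ₁ n g
factorisation-sum zero    q _   _  {n} g v = Σ<-cong n (λ j _ → begin
  𝟙 (notDivByAny? q (suc j)) * g (1 * suc j)
    ≡⟨ cong₂ _*_ (𝟙-yes (λ ()) (notDivByAny? q (suc j))) (cong g (*-identityˡ (suc j))) ⟩
  1 * g (suc j)                               ≡⟨ *-identityˡ _ ⟩
  g (suc j)                                   ∎)
factorisation-sum (suc t) q q≥2 pc {n} g v = begin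
  Σ₁ n (factorSum (suc t) q n g)                       ≡⟨ Σ<-cong n (λ j _ → peel (suc j)) ⟩
  Σ₁ n (λ j → Σ< (suc n) (λ k → factorSum t (q ∘ suc) n (slice (q zero) k g) j))
                                                       ≡⟨ Σ<-comm n (suc n) (λ j k → factorSum t (q ∘ suc) n (slice (q zero) k g) (suc j)) ⟩
  Σ< (suc n) (λ k → Σ₁ n (factorSum t (q ∘ suc) n (slice (q zero) k g)))
                                                       ≡⟨ Σ<-cong (suc n) (λ k _ → inner k) ⟩
  Σ< (suc n) (λ k → Σ₁ n (slice (q zero) k g))        ≡⟨ strip-powers (q zero) (q≥2 zero) g v ⟩
  Σ₁ n g                                               ∎
  where
  peel : ∀ j → factorSum (suc t) q n g j ≡ Σ< (suc n) (λ k → factorSum t (q ∘ suc) n (slice (q zero) k g) j)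
  peel j = begin
    factorSum (suc t) q n g j
      ≡⟨ cong (𝟙 (notDivByAny? q j) *_) (sumTuples-cong (suc t) n (λ ks → sym (*-identityˡ (g (monomial (suc t) q ks * j))))) ⟩
    𝟙 (notDivByAny? q j) * sumTuples (suc t) n (λ ks → 1 * g (monomial (suc t) q ks * j))
      ≡⟨ factorSum-peel t q n (λ _ → 1) g j (pairwiseCoprime-head pc) ⟩
    Σ< (suc n) (λ k → 1 * factorSum t (q ∘ suc) n (slice (q zero) k g) j)
      ≡⟨ Σ<-cong (suc n) (λ k _ → *-identityˡ (factorSum t (q ∘ suc) n (slice (q zero) k g) j)) ⟩
    Σ< (suc n) (λ k → factorSum t (q ∘ suc) n (slice (q zero) k g) j) ∎
  inner : ∀ k → Σ₁ n (factorSum t (q ∘ suc) n (slice (q zero) k g)) ≡ Σ₁ n (slice (q zero) k g)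
  inner k = factorisation-sum t (q ∘ suc) (q≥2 ∘ suc) (pairwiseCoprime-tail pc)
              (slice (q zero) k g) (slice-vanish k g (<⇒≤ (q≥2 zero)) v)

-- c and G with an arbitrary profile f in place of s ↦ W_{r,s,n}, resp. s ↦ y_s(λ);
-- c m' r n L is definitionally cWith m' r n (W L).
cWith : (m' : ℕ) → (Fin (suc m') → ℕ) → ℕ → (ℕ → ℕ) → ℕ
cWith m' r n f = sumRangeIf 1 n (notDivByAny? r) (λ j →
  sumTuples (suc m') n (λ k → k zero * f (prodFin (suc m') (λ l → r l ^ k l) * j)))

GWith : ℕ → ℕ → (ℕ → ℕ) → ℕ
GWith r₁ n f = Σ₁ n (λ j → 𝟙 (¬? (r₁ ∣? j)) * Σ₁ n (λ k → k * f (r₁ ^ k * j)))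

c-as-G : ∀ m' (r : Fin (suc m') → ℕ) → (∀ l → r l ≥ 2) → PairwiseCoprime r →
         ∀ n (f : ℕ → ℕ) → Vanish n f → cWith m' r n f ≡ GWith (r zero) n f
c-as-G m' r r≥2 pc n f v = begin
  cWith m' r n f
    ≡⟨ sumRangeIf-1 n (notDivByAny? r) _ ⟩
  Σ₁ n (λ j → 𝟙 (notDivByAny? r j) * sumTuples (suc m') n (λ ks → ks zero * f (monomial (suc m') r ks * j)))
    ≡⟨ Σ<-cong n (λ j _ → factorSum-peel m' r n (λ k → k) f (suc j) (pairwiseCoprime-head pc)) ⟩
  Σ₁ n (λ j → Σ< (suc n) (λ k → k * factorSum m' (r ∘ suc) n (slice r₁ k f) j))
    ≡⟨ Σ<-comm n (suc n) (λ j k → k * factorSum m' (r ∘ suc) n (slice r₁ k f) (suc j)) ⟩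
  Σ< (suc n) (λ k → Σ₁ n (λ j → k * factorSum m' (r ∘ suc) n (slice r₁ k f) j))
    ≡⟨ Σ<-cong (suc n) (λ k _ → trans (Σ<-* n k _) (cong (k *_) (others k))) ⟩
  Σ< (suc n) (λ k → k * Σ₁ n (slice r₁ k f))
    ≡⟨⟩ -- the term k = 0 vanishes
  Σ₁ n (λ k → k * Σ₁ n (slice r₁ k f))
    ≡⟨ Σ<-cong n (λ k _ → sym (Σ<-* n (suc k) _)) ⟩
  Σ₁ n (λ k → Σ₁ n (λ j → k * slice r₁ k f j))
    ≡⟨ Σ<-comm n n _ ⟩
  Σ₁ n (λ j → Σ₁ n (λ k → k * slice r₁ k f j))
    ≡⟨ Σ<-cong n (λ j _ → indicator-out (suc j)) ⟩
  GWith r₁ n f ∎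
  where
  r₁ = r zero
  others : ∀ k → Σ₁ n (factorSum m' (r ∘ suc) n (slice r₁ k f)) ≡ Σ₁ n (slice r₁ k f)
  others k = factorisation-sum m' (r ∘ suc) (r≥2 ∘ suc) (pairwiseCoprime-tail pc)
               (slice r₁ k f) (slice-vanish k f (<⇒≤ (r≥2 zero)) v)
  -- the indicator [r₁ ∤ j] does not depend on k
  indicator-out : ∀ j → Σ₁ n (λ k → k * slice r₁ k f j) ≡ 𝟙 (¬? (r₁ ∣? j)) * Σ₁ n (λ k → k * f (r₁ ^ k * j))
  indicator-out j = trans (Σ<-cong n (λ k _ → x*[y*z]≡y*[x*z] (suc k) (𝟙 (¬? (r₁ ∣? j))) (f (r₁ ^ suc k * j))))
                          (Σ<-* n (𝟙 (¬? (r₁ ∣? j))) (λ k → suc k * f (r₁ ^ suc k * j)))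

GWith-+ : ∀ r₁ n (a b : ℕ → ℕ) → GWith r₁ n (λ s → a s + b s) ≡ GWith r₁ n a + GWith r₁ n b
GWith-+ r₁ n a b = trans (Σ<-cong n (λ j _ → distrib-j (suc j))) (Σ<-+ n _ _)
  where
  distrib-j : ∀ j → 𝟙 (¬? (r₁ ∣? j)) * Σ₁ n (λ k → k * (a (r₁ ^ k * j) + b (r₁ ^ k * j)))
    ≡ 𝟙 (¬? (r₁ ∣? j)) * Σ₁ n (λ k → k * a (r₁ ^ k * j)) + 𝟙 (¬? (r₁ ∣? j)) * Σ₁ n (λ k → k * b (r₁ ^ k * j))
  distrib-j j = trans (cong (𝟙 (¬? (r₁ ∣? j)) *_) (trans (Σ<-cong n distrib-k) (Σ<-+ n _ _)))
                      (*-distribˡ-+ (𝟙 (¬? (r₁ ∣? j))) _ _)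
    where
    distrib-k : ∀ k → k < n → suc k * (a (r₁ ^ suc k * j) + b (r₁ ^ suc k * j))
                            ≡ suc k * a (r₁ ^ suc k * j) + suc k * b (r₁ ^ suc k * j)
    distrib-k k _ = *-distribˡ-+ (suc k) (a (r₁ ^ suc k * j)) (b (r₁ ^ suc k * j))

GWith-sum : ∀ r₁ n (F : List ℕ → ℕ → ℕ) L →
            GWith r₁ n (λ s → sum (map (λ x → F x s) L)) ≡ sum (map (λ x → GWith r₁ n (F x)) L)
GWith-sum r₁ n F []      = Σ<-zero n (λ j _ → trans (cong (𝟙 (¬? (r₁ ∣? suc j)) *_) (Σ<-zero n (λ k _ → *-zeroʳ (suc k))))
                                                      (*-zeroʳ (𝟙 (¬? (r₁ ∣? suc j)))))
GWith-sum r₁ n F (x ∷ L) = trans (GWith-+ r₁ n (F x) (λ s → sum (map (λ z → F z s) L)))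
                                 (cong (GWith r₁ n (F x) +_) (GWith-sum r₁ n F L))

G-as-GWith : ∀ r₁ n λ′ → G r₁ n λ′ ≡ GWith r₁ n (λ s → y s λ′)
G-as-GWith r₁ n λ′ = trans (sumRangeIf-1 n (λ j → ¬? (r₁ ∣? j)) _)
  (Σ<-cong n (λ j _ → cong (𝟙 (¬? (r₁ ∣? suc j)) *_) (sumRange-1 n (λ k → k * y (r₁ ^ k * suc j) λ′))))

mult≤length : ∀ i xs → mult i xs ≤ length xs
mult≤length i []       = z≤n
mult≤length i (p ∷ ps) with p ≟ i
... | yes _ = s≤s (mult≤length i ps)
... | no _  = m≤n⇒m≤1+n (mult≤length i ps)

length≤sum : ∀ xs → All (λ p → p ≥ 1) xs → length xs ≤ sum xs
length≤sum []       []       = z≤n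
length≤sum (p ∷ ps) (h ∷ hs) = +-mono-≤ h (length≤sum ps hs)

-- No part occurs more than n times in a partition of n, so y_s(λ) = 0 for s > n.
y-vanish : ∀ n λ′ → IsPartition n λ′ → Vanish n (λ s → y s λ′)
y-vanish n λ′ (positive , _ , sum≡n) s n<s =
  cong length (filter-none (λ i → s ≤? mult i λ′) (universal too-few (range 1 (sum λ′))))
  where
  too-few : ∀ i → ¬ s ≤ mult i λ′
  too-few i s≤m = <⇒≱ n<s (≤-trans s≤m (≤-trans (mult≤length i λ′) length≤n))
    where
    length≤n : length λ′ ≤ n
    length≤n = subst (length λ′ ≤_) sum≡n (length≤sum λ′ positive)

W-vanish : ∀ {d} (r : Fin d → ℕ) n L → Enumerates r n L → Vanish n (W L)
W-vanish r n L (_ , iff) s n<s = go L (λ x x∈L → member-vanish (Equivalence.to (iff x) x∈L))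
  where
  member-vanish : ∀ {x} → IsCP r n x → Vanish n (λ s → y s x)
  member-vanish (partition , _) = y-vanish n _ partition
  go : ∀ L′ → (∀ x → x ∈ L′ → Vanish n (λ s → y s x)) → sum (map (y s) L′) ≡ 0
  go []       _  = refl
  go (x ∷ L′) vs = cong₂ _+_ (vs x (here refl) s n<s) (go L′ (λ z z∈ → vs z (there z∈)))

proposition3p2 : (m' : ℕ) (r : Fin (suc m') → ℕ) → (∀ l → r l ≥ 2) → PairwiseCoprime r →
                 (n : ℕ) (L : List (List ℕ)) → Enumerates r n L →
                 c m' r n L ≡ sum (map (G (r zero) n) L)
proposition3p2 m' r r≥2 pc n L enum = begin
  c m' r n L                                               ≡⟨ c-as-G m' r r≥2 pc n (W L) (W-vanish r n L enum) ⟩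
  GWith (r zero) n (W L)                                   ≡⟨ GWith-sum (r zero) n (λ x s → y s x) L ⟩
  sum (map (λ x → GWith (r zero) n (λ s → y s x)) L)
    ≡⟨ cong sum (map-cong (λ x → sym (G-as-GWith (r zero) n x)) L) ⟩
  sum (map (G (r zero) n) L)                               ∎
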